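{- Let $n\ge1$ and $0\le r\le n$. Then there exist two disjoint sublattices $S_1(n,r)$ and $S_2(n,r)$ of $S(n,r)$ with $S(n,r)=S_1(n,r)\cup S_2(n,r)$ such that: (i) if $0\le r<n$, then $S_i(n,r)\cong S(n-1,r)$ for $i=1,2$; (ii) if $r=n$, then $S_i(n,n)\cong S(n-1,n-1)$ for $i=1,2$.
   Context: For integers $0\le r\le n$, $A(n,r)$ is an alphabet of $n+1$ formal symbols $\tilde 1,\dots,\tilde r,\ 0^\S,\ \bar 1,\dots,\overline{n-r}$, totally ordered by $\overline{n-r}\prec\cdots\prec\bar1\prec 0^\S\prec\tilde1\prec\cdots\prec\tilde r$. $S(n,r)$ is the set of strings $w=i_1\cdots i_r\,|\,j_1\cdots j_{n-r}$ with $i_k\in\{\tilde1,\dots,\tilde r,0^\S\}$, $j_k\in\{0^\S,\bar1,\dots,\overline{n-r}\}$ such that for some $0\le p\le r$, $1\le q\le n-r+1$: $i_1\succ\cdots\succ i_p\succ 0^\S=i_{p+1}=\cdots=i_r$ and $j_1=\cdots=j_{q-1}=0^\S\succ j_q\succ\cdots\succ j_{n-r}$, ordered componentwise by $\preceq$; it is a lattice with componentwise minimum and maximum as meet and join. $S(0,0)$ is a single (empty) string. A sublattice is a subset closed under meet and join. -}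

module Defs where

open import Data.Nat as ℕ using (ℕ; zero; suc; _∸_)
open import Data.Integer as ℤ using (ℤ; +_; -_; _⊓_; _⊔_)
open import Data.Fin using (Fin; toℕ)
open import Data.Vec using (Vec; lookup; zipWith)
open import Data.Product using (Σ; ∃; _×_; _,_)
open import Relation.Binary.PropositionalEquality using (_≡_)

-- Encoding of the alphabet A(n,r): the symbol  ~k  is the integer  + k,
-- 0^S is  + 0,  and  \bar k  is  - (+ k).  The total order ≺ on A(n,r)
-- is then exactly the usual order on ℤ, restricted to [-(n-r), r].

-- Raw strings  i₁⋯i_r | j₁⋯j_{n-r}  (0-based positions in the vectors).
Str : ℕ → ℕ → Set
Str n r = Vec ℤ r × Vec ℤ (n ∸ r)

LeftOK : (r : ℕ) → Vec ℤ r → Set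
LeftOK r i = Σ ℕ λ p → (p ℕ.≤ r)
  × (∀ (k : Fin r) → (+ 0 ℤ.≤ lookup i k) × (lookup i k ℤ.≤ + r))
  × (∀ (k : Fin r) → toℕ k ℕ.< p → + 0 ℤ.< lookup i k)
  × (∀ (k l : Fin r) → toℕ l ≡ suc (toℕ k) → toℕ l ℕ.< p → lookup i l ℤ.< lookup i k)
  × (∀ (k : Fin r) → p ℕ.≤ toℕ k → lookup i k ≡ + 0)

-- Second half (length m = n-r): ∃ 1 ≤ q ≤ m+1 with
-- j₁ = ⋯ = j_{q-1} = 0^S ≻ j_q ≻ ⋯ ≻ j_m, letters from {0^S,\bar1,…,\bar m}.
-- (1-based position of the 0-based index k is suc (toℕ k).)
RightOK : (m : ℕ) → Vec ℤ m → Set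
RightOK m j = Σ ℕ λ q → (1 ℕ.≤ q) × (q ℕ.≤ suc m)
  × (∀ (k : Fin m) → (- (+ m) ℤ.≤ lookup j k) × (lookup j k ℤ.≤ + 0))
  × (∀ (k : Fin m) → suc (toℕ k) ℕ.< q → lookup j k ≡ + 0)
  × (∀ (k : Fin m) → q ℕ.≤ suc (toℕ k) → lookup j k ℤ.< + 0)
  × (∀ (k l : Fin m) → toℕ l ≡ suc (toℕ k) → q ℕ.≤ suc (toℕ k) → lookup j l ℤ.< lookup j k)

InS : (n r : ℕ) → Str n r → Set
InS n r (i , j) = LeftOK r i × RightOK (n ∸ r) j

_∧ˢ_ : ∀ {n r} → Str n r → Str n r → Str n r
(i , j) ∧ˢ (i' , j') = zipWith _⊓_ i i' , zipWith _⊓_ j j'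

_∨ˢ_ : ∀ {n r} → Str n r → Str n r → Str n r
(i , j) ∨ˢ (i' , j') = zipWith _⊔_ i i' , zipWith _⊔_ j j'

record IsSublattice (n r : ℕ) (P : Str n r → Set) : Set where
  field
    sub     : ∀ w → P w → InS n r w
    closed∧ : ∀ w w' → P w → P w' → P (w ∧ˢ w')
    closed∨ : ∀ w w' → P w → P w' → P (w ∨ˢ w')

-- Lattice isomorphism between the sublattice P ⊆ S(n,r) and S(n',r'):
-- mutually inverse maps (given as functions on raw strings, only their
-- values on the respective subsets matter) preserving meet and join.
record LatIso (n r : ℕ) (P : Str n r → Set) (n' r' : ℕ) : Set where
  field
    to      : Str n r → Str n' r'
    from    : Str n' r' → Str n r
    to-in   : ∀ w → P w → InS n' r' (to w)
    from-in : ∀ v → InS n' r' v → P (from v)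
    from-to : ∀ w → P w → from (to w) ≡ w
    to-from : ∀ v → InS n' r' v → to (from v) ≡ v
    to-∧    : ∀ w w' → P w → P w' → to (w ∧ˢ w') ≡ to w ∧ˢ to w'
    to-∨    : ∀ w w' → P w → P w' → to (w ∨ˢ w') ≡ to w ∨ˢ to w'

-- Reading ~k, 0^S and \bar k as k, 0 and -k, a string lies in S(n,r) exactly when each half is
-- a chain x₁ ≻₀ x₂ ≻₀ ⋯ (strictly decreasing, except that 0 may repeat) with letters in [0, r],
-- resp. [-(n-r), 0]. Componentwise min and max preserve such chains, and also preserve whether a
-- given coordinate (first or last letter) equals a given constant; this yields the sublattices.
-- For r < n, split by whether the last letter of the right half is \overline{n-r}: if so, delete
-- it; if not, the n-r letters cannot all be strictly decreasing negatives above -(n-r), so the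
-- half starts with 0^S, and deleting that is the isomorphism. For r = n, split the left half
-- dually by whether its first letter is ~n, deleting it or else the trailing 0^S.
module Submission where

open import Defs
open import Algebra.Definitions using (Selective)
open import Data.Empty using (⊥; ⊥-elim)
open import Data.Fin using (toℕ; zero; suc)
open import Data.Integer as ℤ
  using (ℤ; +_; -_; -[1+_]; _⊓_; _⊔_; +<+; -<+; -<-; +≤+; -≤+; -≤-)
import Data.Integer.Properties as ℤP
open import Data.Nat using (ℕ; zero; suc; z≤n; s≤s; _≤_; _<_; _∸_)
import Data.Nat.Properties as ℕP
open import Data.Product using (Σ; _×_; _,_; proj₁; proj₂)
open import Data.Sum as Sum using (_⊎_; inj₁; inj₂)
open import Data.Vec using (Vec; []; _∷_; lookup; zipWith; head; tail; init; last; _∷ʳ_; initLast)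
open import Data.Vec.Properties using (init-∷ʳ; last-∷ʳ)
open import Data.Vec.Relation.Unary.All as All using (All; []; _∷_)
import Data.Vec.Relation.Unary.All.Properties as All
open import Data.Vec.Relation.Unary.Linked as Linked using (Linked; []; [-]; _∷_)
open import Data.Vec.Relation.Unary.Linked.Properties using (Linked⇒All; lookup⁺)
open import Function using (id; _∘_)
open import Relation.Binary.Definitions using (Transitive)
open import Relation.Binary.PropositionalEquality
  using (_≡_; _≢_; refl; sym; trans; cong; cong₂; subst; subst₂; ≢-sym)
open import Relation.Nullary using (¬_; yes; no)

private
  variable
    k l : ℕ
    lo hi x y x' y' : ℤ

<-glb : x ℤ.< y → x ℤ.< y' → x ℤ.< y ⊓ y'
<-glb {y = y} {y' = y'} p q with ℤP.⊓-sel y y'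
... | inj₁ e rewrite e = p
... | inj₂ e rewrite e = q

⊓-mono-< : y ℤ.< x → y' ℤ.< x' → y ⊓ y' ℤ.< x ⊓ x'
⊓-mono-< {y} {y' = y'} p q =
  <-glb (ℤP.≤-<-trans (ℤP.i⊓j≤i y y') p) (ℤP.≤-<-trans (ℤP.i⊓j≤j y y') q)

-[1+m]<⇒-m≤ : ∀ m {x} → -[1+ m ] ℤ.< x → - (+ m) ℤ.≤ x
-[1+m]<⇒-m≤ zero    {+ _}      _         = +≤+ z≤n
-[1+m]<⇒-m≤ zero    { -[1+ _ ]} (-<- ())
-[1+m]<⇒-m≤ (suc m) {+ _}      _         = -≤+
-[1+m]<⇒-m≤ (suc m) { -[1+ _ ]} (-<- j<m) = -≤- (ℕP.≤-pred j<m)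

-m≤⇒-[1+m]< : ∀ m {x} → - (+ m) ℤ.≤ x → -[1+ m ] ℤ.< x
-m≤⇒-[1+m]< m = ℤP.<-≤-trans (-[1+m]<-m m)
  where
  -[1+m]<-m : ∀ m → -[1+ m ] ℤ.< - (+ m)
  -[1+m]<-m zero    = -<+
  -[1+m]<-m (suc m) = -<- ℕP.≤-refl

selective-preserves : ∀ {_∙_} (C : ℤ → Set) → Selective _≡_ _∙_ → C x → C y → C (x ∙ y)
selective-preserves {x} {y} C sel cx cy with sel x y
... | inj₁ e = subst C (sym e) cx
... | inj₂ e = subst C (sym e) cy

module _ {A : Set} {P : A → Set} where

  all-head : {v : Vec A (suc k)} → All P v → P (head v)
  all-head (p ∷ _) = p

  all-init : {v : Vec A (suc k)} → All P v → All P (init v)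
  all-init {v = _ ∷ []}    (_ ∷ [])  = []
  all-init {v = _ ∷ _ ∷ _} (p ∷ ps) = p ∷ all-init ps

  all-last : {v : Vec A (suc k)} → All P v → P (last v)
  all-last {v = _ ∷ []}    (p ∷ [])  = p
  all-last {v = _ ∷ _ ∷ _} (_ ∷ ps) = all-last ps

  all-∷ʳ : ∀ {x} {xs : Vec A k} → All P xs → P x → All P (xs ∷ʳ x)
  all-∷ʳ []       px = px ∷ []
  all-∷ʳ (p ∷ ps) px = p ∷ all-∷ʳ ps px

module _ {A : Set} where

  init-∷ʳ-last : (v : Vec A (suc k)) → init v ∷ʳ last v ≡ v
  init-∷ʳ-last v = sym (proj₂ (proj₂ (initLast v)))

  init-zipWith : (_∙_ : A → A → A) (v w : Vec A (suc k)) →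
    init (zipWith _∙_ v w) ≡ zipWith _∙_ (init v) (init w)
  init-zipWith _∙_ (x ∷ [])        (y ∷ [])        = refl
  init-zipWith _∙_ (x ∷ v@(_ ∷ _)) (y ∷ w@(_ ∷ _)) = cong (x ∙ y ∷_) (init-zipWith _∙_ v w)

linked-zipWith⁺ : ∀ {A : Set} {R : A → A → Set} {f : A → A → A} {v w : Vec A k} →
  (∀ {x y x' y'} → R x y → R x' y' → R (f x x') (f y y')) →
  Linked R v → Linked R w → Linked R (zipWith f v w)
linked-zipWith⁺ _ []  []  = []
linked-zipWith⁺ _ [-] [-] = [-]
linked-zipWith⁺ {v = _ ∷ _ ∷ _} {w = _ ∷ _ ∷ _} f-mono (r ∷ rs) (r' ∷ rs') =
  f-mono r r' ∷ linked-zipWith⁺ f-mono rs rs'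

adjacent⇒linked : ∀ {A : Set} {R : A → A → Set} {v : Vec A k} →
  (∀ i j → toℕ j ≡ suc (toℕ i) → R (lookup v i) (lookup v j)) → Linked R v
adjacent⇒linked {v = []}        _   = []
adjacent⇒linked {v = _ ∷ []}    _   = [-]
adjacent⇒linked {v = _ ∷ _ ∷ _} adj =
  adj zero (suc zero) refl ∷ adjacent⇒linked (λ i j e → adj (suc i) (suc j) (cong suc e))

infix 4 _≻₀_
_≻₀_ : ℤ → ℤ → Set
x ≻₀ y = y ℤ.< x ⊎ (x ≡ + 0 × y ≡ + 0)

≻₀-trans : Transitive _≻₀_
≻₀-trans (inj₁ y<x)           (inj₁ z<y)           = inj₁ (ℤP.<-trans z<y y<x)
≻₀-trans (inj₁ y<x)           (inj₂ (refl , refl)) = inj₁ y<x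
≻₀-trans (inj₂ (refl , refl)) (inj₁ z<0)           = inj₁ z<0
≻₀-trans (inj₂ (refl , refl)) (inj₂ (_ , refl))    = inj₂ (refl , refl)

≻₀⇒≥ : x ≻₀ y → y ℤ.≤ x
≻₀⇒≥ (inj₁ y<x)           = ℤP.<⇒≤ y<x
≻₀⇒≥ (inj₂ (refl , refl)) = ℤP.≤-refl

≻₀⇒<ˡ : x ≻₀ y → x ≢ + 0 → y ℤ.< x
≻₀⇒<ˡ (inj₁ y<x)       _   = y<x
≻₀⇒<ˡ (inj₂ (x≡0 , _)) x≢0 = ⊥-elim (x≢0 x≡0)

≻₀⇒<ʳ : x ≻₀ y → y ≢ + 0 → y ℤ.< x
≻₀⇒<ʳ (inj₁ y<x)       _   = y<x
≻₀⇒<ʳ (inj₂ (_ , y≡0)) y≢0 = ⊥-elim (y≢0 y≡0)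

≻₀-zero : + 0 ℤ.≤ x → x ≻₀ + 0
≻₀-zero {+ zero}  _ = inj₂ (refl , refl)
≻₀-zero {+ suc _} _ = inj₁ (+<+ (s≤s z≤n))

zero-≻₀ : y ℤ.≤ + 0 → + 0 ≻₀ y
zero-≻₀ { -[1+ _ ]} _ = inj₁ -<+
zero-≻₀ {+ zero}    _ = inj₂ (refl , refl)
zero-≻₀ {+ suc _}   (+≤+ ())

≻₀-neg : x ≻₀ y → - y ≻₀ - x
≻₀-neg (inj₁ y<x)           = inj₁ (ℤP.neg-mono-< y<x)
≻₀-neg (inj₂ (refl , refl)) = inj₂ (refl , refl)

≻₀-⊓-zero : y ℤ.< x → x ⊓ + 0 ≻₀ y ⊓ + 0
≻₀-⊓-zero {y} {x} y<x with y ℤ.<? + 0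
... | yes y<0 = inj₁ (ℤP.≤-<-trans (ℤP.i⊓j≤i y (+ 0)) (<-glb y<x y<0))
... | no y≮0  = inj₂ (ℤP.i≥j⇒i⊓j≡j (ℤP.<⇒≤ (ℤP.≤-<-trans 0≤y y<x)) , ℤP.i≥j⇒i⊓j≡j 0≤y)
  where
  0≤y : + 0 ℤ.≤ y
  0≤y = ℤP.≮⇒≥ y≮0

≻₀-⊓ : x ≻₀ y → x' ≻₀ y' → x ⊓ x' ≻₀ y ⊓ y'
≻₀-⊓ (inj₁ y<x) (inj₁ y'<x') = inj₁ (⊓-mono-< y<x y'<x')
≻₀-⊓ (inj₁ y<x) (inj₂ (refl , refl)) = ≻₀-⊓-zero y<x
≻₀-⊓ {x' = x'} {y' = y'} (inj₂ (refl , refl)) (inj₁ y'<x') =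
  subst₂ _≻₀_ (ℤP.⊓-comm x' (+ 0)) (ℤP.⊓-comm y' (+ 0)) (≻₀-⊓-zero y'<x')
≻₀-⊓ (inj₂ (refl , refl)) (inj₂ (refl , refl)) = inj₂ (refl , refl)

≻₀-⊔ : x ≻₀ y → x' ≻₀ y' → x ⊔ x' ≻₀ y ⊔ y'
≻₀-⊔ {x} {y} {x'} {y'} p q =
  subst₂ _≻₀_ (ℤP.neg-involutive _) (ℤP.neg-involutive _)
    (≻₀-neg (subst₂ _≻₀_ (sym (ℤP.neg-distrib-⊔-⊓ y y')) (sym (ℤP.neg-distrib-⊔-⊓ x x'))
      (≻₀-⊓ (≻₀-neg p) (≻₀-neg q))))

Chain : Vec ℤ k → Set
Chain = Linked _≻₀_

∷-chain : {xs : Vec ℤ k} → All (x ≻₀_) xs → Chain xs → Chain (x ∷ xs)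
∷-chain []      []  = [-]
∷-chain (d ∷ _) ch  = d ∷ ch

∷ʳ-chain : {xs : Vec ℤ k} → All (_≻₀ x) xs → Chain xs → Chain (xs ∷ʳ x)
∷ʳ-chain []                []       = [-]
∷ʳ-chain (d ∷ [])          [-]      = d ∷ [-]
∷ʳ-chain (_ ∷ ds@(_ ∷ _)) (r ∷ ch) = r ∷ ∷ʳ-chain ds ch

chain-init : {v : Vec ℤ (suc k)} → Chain v → Chain (init v)
chain-init {v = _ ∷ []}        [-]       = []
chain-init {v = _ ∷ _ ∷ []}    (_ ∷ [-]) = [-]
chain-init {v = _ ∷ _ ∷ _ ∷ _} (r ∷ ch)  = r ∷ chain-init ch

chain⇒head-dominates : {xs : Vec ℤ k} → Chain (x ∷ xs) → All (x ≻₀_) xs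
chain⇒head-dominates [-]      = []
chain⇒head-dominates (r ∷ ch) = Linked⇒All ≻₀-trans r ch

chain⇒last-dominated : {v : Vec ℤ (suc k)} → Chain v → All (_≻₀ last v) (init v)
chain⇒last-dominated {v = _ ∷ []}        [-]            = []
chain⇒last-dominated {v = _ ∷ _ ∷ []}    (r ∷ [-])      = r ∷ []
chain⇒last-dominated {v = _ ∷ _ ∷ _ ∷ _} (r ∷ ch) with chain⇒last-dominated ch
... | ds@(d ∷ _) = ≻₀-trans r d ∷ ds

chain⇒head-maximal : {v : Vec ℤ (suc k)} → Chain v → All (ℤ._≤ head v) v
chain⇒head-maximal {v = _ ∷ _} ch = ℤP.≤-refl ∷ All.map ≻₀⇒≥ (chain⇒head-dominates ch)

chain⇒last-minimal : {v : Vec ℤ (suc k)} → Chain v → All (last v ℤ.≤_) v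
chain⇒last-minimal {v = _ ∷ []}    [-]      = ℤP.≤-refl ∷ []
chain⇒last-minimal {v = _ ∷ _ ∷ _} (r ∷ ch) with chain⇒last-minimal ch
... | ms@(m ∷ _) = ℤP.≤-trans m (≻₀⇒≥ r) ∷ ms

chain-adjacent : {v : Vec ℤ k} → Chain v →
  ∀ i j → toℕ j ≡ suc (toℕ i) → lookup v i ≻₀ lookup v j
chain-adjacent ch i j j≡1+i = lookup⁺ ≻₀-trans ch (ℕP.≤-reflexive (sym j≡1+i))

chain-spread : {v : Vec ℤ (suc k)} → Chain v →
  + k ℤ.+ last v ℤ.≤ head v ⊎ (last v ℤ.≤ + 0 × + 0 ℤ.≤ head v)
chain-spread {v = x ∷ []} [-] = inj₁ (ℤP.≤-reflexive (ℤP.+-identityˡ x))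
chain-spread {suc k} {v = x ∷ y ∷ ys} (x≻y ∷ ch) with chain-spread ch | x≻y
... | inj₁ spread | inj₁ y<x =
  inj₁ (subst (ℤ._≤ x) (sym (ℤP.suc-+ k (last (y ∷ ys))))
    (ℤP.≤-trans (ℤP.suc-mono spread) (ℤP.i<j⇒suc[i]≤j y<x)))
... | inj₁ spread | inj₂ (refl , refl) =
  inj₂ (ℤP.≤-trans (ℤP.i≤j⇒i≤k+j (+ k) ℤP.≤-refl) spread , ℤP.≤-refl)
... | inj₂ (last≤0 , 0≤y) | _ = inj₂ (last≤0 , ℤP.≤-trans 0≤y (≻₀⇒≥ x≻y))

Within : ℤ → ℤ → ℤ → Set
Within lo hi x = lo ℤ.≤ x × x ℤ.≤ hi

within-weakenʳ : ∀ {r} → Within lo (+ r) x → Within lo (+ suc r) x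
within-weakenʳ {r = r} (lo≤x , x≤r) = lo≤x , ℤP.≤-trans x≤r (+≤+ (ℕP.n≤1+n r))

within-weakenˡ : ∀ {m} → Within (- (+ m)) hi x → Within -[1+ m ] hi x
within-weakenˡ {m = m} (m≤x , x≤hi) = ℤP.<⇒≤ (-m≤⇒-[1+m]< m m≤x) , x≤hi

ChainIn : ℤ → ℤ → Vec ℤ k → Set
ChainIn lo hi v = All (Within lo hi) v × Chain v

Closed : (Vec ℤ k → Set) → Set
Closed P = ∀ {v w} → P v → P w → P (zipWith _⊓_ v w) × P (zipWith _⊔_ v w)

chainIn-closed : Closed (ChainIn {k} lo hi)
chainIn-closed (bnds , ch) (bnds' , ch') =
  (All.zipWith within-⊓ bnds bnds' , linked-zipWith⁺ ≻₀-⊓ ch ch') ,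
  (All.zipWith within-⊔ bnds bnds' , linked-zipWith⁺ ≻₀-⊔ ch ch')
  where
  within-⊓ : Within lo hi x → Within lo hi y → Within lo hi (x ⊓ y)
  within-⊓ (lo≤x , x≤hi) (lo≤y , _) = ℤP.⊓-glb lo≤x lo≤y , ℤP.i≤j⇒i⊓k≤j _ x≤hi
  within-⊔ : Within lo hi x → Within lo hi y → Within lo hi (x ⊔ y)
  within-⊔ (lo≤x , x≤hi) (_ , y≤hi) = ℤP.i≤j⇒i≤j⊔k _ lo≤x , ℤP.⊔-lub x≤hi y≤hi

Left : (r : ℕ) → Vec ℤ r → Set
Left r = ChainIn (+ 0) (+ r)

Right : (m : ℕ) → Vec ℤ m → Set
Right m = ChainIn (- (+ m)) (+ 0)

positivePrefix : {v : Vec ℤ k} → All (+ 0 ℤ.≤_) v → Chain v →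
  Σ ℕ λ p → p ≤ k × (∀ i → toℕ i < p → + 0 ℤ.< lookup v i)
                  × (∀ i → p ≤ toℕ i → lookup v i ≡ + 0)
positivePrefix {v = []} _ _ = 0 , z≤n , (λ ()) , (λ ())
positivePrefix {v = + zero ∷ xs} (_ ∷ nonneg) ch = 0 , z≤n , (λ _ ()) , zeros
  where
  zeros : ∀ i → 0 ≤ toℕ i → lookup (+ 0 ∷ xs) i ≡ + 0
  zeros zero    _ = refl
  zeros (suc i) _ with All.lookup⁺ (chain⇒head-dominates ch) i | All.lookup⁺ nonneg i
  ... | inj₁ y<0       | 0≤y = ⊥-elim (ℤP.<⇒≱ y<0 0≤y)
  ... | inj₂ (_ , y≡0) | _   = y≡0
positivePrefix {v = + suc a ∷ xs} (_ ∷ nonneg) ch with positivePrefix nonneg (Linked.tail ch)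
... | p , p≤k , pos , zer = suc p , s≤s p≤k , pos′ , zer′
  where
  pos′ : ∀ i → toℕ i < suc p → + 0 ℤ.< lookup (+ suc a ∷ xs) i
  pos′ zero    _         = +<+ (s≤s z≤n)
  pos′ (suc i) (s≤s i<p) = pos i i<p
  zer′ : ∀ i → suc p ≤ toℕ i → lookup (+ suc a ∷ xs) i ≡ + 0
  zer′ (suc i) (s≤s p≤i) = zer i p≤i

zeroPrefix : {v : Vec ℤ k} → All (ℤ._≤ + 0) v → Chain v →
  Σ ℕ λ z → z ≤ k × (∀ i → toℕ i < z → lookup v i ≡ + 0)
                  × (∀ i → z ≤ toℕ i → lookup v i ℤ.< + 0)
zeroPrefix {v = []} _ _ = 0 , z≤n , (λ ()) , (λ ())
zeroPrefix {v = -[1+ a ] ∷ xs} _ ch = 0 , z≤n , (λ _ ()) , negs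
  where
  negs : ∀ i → 0 ≤ toℕ i → lookup (-[1+ a ] ∷ xs) i ℤ.< + 0
  negs zero    _ = -<+
  negs (suc i) _ = ℤP.<-trans (≻₀⇒<ˡ (All.lookup⁺ (chain⇒head-dominates ch) i) (λ ())) -<+
zeroPrefix {v = + zero ∷ xs} (_ ∷ nonpos) ch with zeroPrefix nonpos (Linked.tail ch)
... | z , z≤k , zer , neg = suc z , s≤s z≤k , zer′ , neg′
  where
  zer′ : ∀ i → toℕ i < suc z → lookup (+ 0 ∷ xs) i ≡ + 0
  zer′ zero    _         = refl
  zer′ (suc i) (s≤s i<z) = zer i i<z
  neg′ : ∀ i → suc z ≤ toℕ i → lookup (+ 0 ∷ xs) i ℤ.< + 0
  neg′ (suc i) (s≤s z≤i) = neg i z≤i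
zeroPrefix {v = + suc _ ∷ _} (+≤+ () ∷ _) _

leftOK⇒Left : ∀ {r} {i : Vec ℤ r} → LeftOK r i → Left r i
leftOK⇒Left {i = i} (p , _ , bnds , _ , adj , zer) = All.lookup⁻ bnds , adjacent⇒linked step
  where
  step : ∀ a b → toℕ b ≡ suc (toℕ a) → lookup i a ≻₀ lookup i b
  step a b b≡1+a with toℕ b ℕP.<? p
  ... | yes b<p = inj₁ (adj a b b≡1+a b<p)
  ... | no b≮p rewrite zer b (ℕP.≮⇒≥ b≮p) = ≻₀-zero (proj₁ (bnds a))

Left⇒leftOK : ∀ {r} {i : Vec ℤ r} → Left r i → LeftOK r i
Left⇒leftOK {i = i} (bnds , ch) with positivePrefix (All.map proj₁ bnds) ch
... | p , p≤r , pos , zer = p , p≤r , All.lookup⁺ bnds , pos , adj , zer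
  where
  adj : ∀ a b → toℕ b ≡ suc (toℕ a) → toℕ b < p → lookup i b ℤ.< lookup i a
  adj a b b≡1+a b<p = ≻₀⇒<ʳ (chain-adjacent ch a b b≡1+a) (≢-sym (ℤP.<⇒≢ (pos b b<p)))

rightOK⇒Right : ∀ {m} {j : Vec ℤ m} → RightOK m j → Right m j
rightOK⇒Right {j = j} (q , _ , _ , bnds , zer , _ , adj) = All.lookup⁻ bnds , adjacent⇒linked step
  where
  step : ∀ a b → toℕ b ≡ suc (toℕ a) → lookup j a ≻₀ lookup j b
  step a b b≡1+a with q ℕP.≤? suc (toℕ a)
  ... | yes q≤1+a = inj₁ (adj a b b≡1+a q≤1+a)
  ... | no q≰1+a rewrite zer a (ℕP.≰⇒> q≰1+a) = zero-≻₀ (proj₂ (bnds b))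

Right⇒rightOK : ∀ {m} {j : Vec ℤ m} → Right m j → RightOK m j
Right⇒rightOK {j = j} (bnds , ch) with zeroPrefix (All.map proj₂ bnds) ch
... | z , z≤m , zer , neg = suc z , s≤s z≤n , s≤s z≤m , All.lookup⁺ bnds , zer′ , neg′ , adj
  where
  zer′ : ∀ a → suc (toℕ a) < suc z → lookup j a ≡ + 0
  zer′ a (s≤s a<z) = zer a a<z
  neg′ : ∀ a → suc z ≤ suc (toℕ a) → lookup j a ℤ.< + 0
  neg′ a (s≤s z≤a) = neg a z≤a
  adj : ∀ a b → toℕ b ≡ suc (toℕ a) → suc z ≤ suc (toℕ a) → lookup j b ℤ.< lookup j a
  adj a b b≡1+a z<1+a = ≻₀⇒<ˡ (chain-adjacent ch a b b≡1+a) (ℤP.<⇒≢ (neg′ a z<1+a))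

-- The maps used are tail, init and id, which commute with every componentwise operation.
record VecIso (P : Vec ℤ k → Set) (Q : Vec ℤ l → Set) : Set where
  field
    to         : Vec ℤ k → Vec ℤ l
    from       : Vec ℤ l → Vec ℤ k
    to-in      : ∀ {v} → P v → Q (to v)
    from-in    : ∀ {w} → Q w → P (from w)
    from-to    : ∀ {v} → P v → from (to v) ≡ v
    to-from    : ∀ w → to (from w) ≡ w
    to-zipWith : ∀ _∙_ v v' → to (zipWith _∙_ v v') ≡ zipWith _∙_ (to v) (to v')

Restrict : (Vec ℤ k → Set) → (Vec ℤ k → ℤ) → (ℤ → Set) → Vec ℤ k → Set
Restrict OK f C v = OK v × C (f v)

leftTop≅ : ∀ r → VecIso (Restrict (Left (suc r)) head (_≡ + suc r)) (Left r)
leftTop≅ r = record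
  { to         = tail
  ; from       = + suc r ∷_
  ; to-in      = to-in
  ; from-in    = from-in
  ; from-to    = λ { {_ ∷ _} (_ , refl) → refl }
  ; to-from    = λ _ → refl
  ; to-zipWith = λ { _ (_ ∷ _) (_ ∷ _) → refl }
  }
  where
  below : Within (+ 0) (+ suc r) y × + suc r ≻₀ y → Within (+ 0) (+ r) y
  below ((0≤y , _) , d) = 0≤y , ℤP.i<j⇒i≤pred[j] (≻₀⇒<ˡ d (λ ()))
  to-in : ∀ {v} → Restrict (Left (suc r)) head (_≡ + suc r) v → Left r (tail v)
  to-in {_ ∷ _} ((_ ∷ bnds , ch) , refl) =
    All.map below (All.zip (bnds , chain⇒head-dominates ch)) , Linked.tail ch
  from-in : ∀ {w} → Left r w → Restrict (Left (suc r)) head (_≡ + suc r) (+ suc r ∷ w)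
  from-in (bnds , ch) =
    ((+≤+ z≤n , ℤP.≤-refl) ∷ All.map within-weakenʳ bnds ,
     ∷-chain (All.map (inj₁ ∘ ℤP.i≤pred[j]⇒i<j ∘ proj₂) bnds) ch) , refl

leftRest-last≡0 : ∀ {r} {v} → Restrict (Left (suc r)) head (_≢ + suc r) v → last v ≡ + 0
leftRest-last≡0 {r} {x ∷ xs} ((bnds , ch) , x≢) =
  ℤP.≤-antisym (ℤP.≮⇒≥ 0≮last) (proj₁ (all-last bnds))
  where
  open ℤP.≤-Reasoning
  x≤r : x ℤ.≤ + r
  x≤r = ℤP.i<j⇒i≤pred[j] (ℤP.≤∧≢⇒< (proj₂ (All.head bnds)) x≢)
  0≮last : ¬ (+ 0 ℤ.< last (x ∷ xs))
  0≮last 0<last with chain-spread ch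
  ... | inj₂ (last≤0 , _) = ℤP.<⇒≱ 0<last last≤0
  ... | inj₁ spread = ℤP.<-irrefl refl (begin-strict
    + r                     ≡⟨ sym (ℤP.+-identityʳ (+ r)) ⟩
    + r ℤ.+ + 0             <⟨ ℤP.+-monoʳ-< (+ r) 0<last ⟩
    + r ℤ.+ last (x ∷ xs)   ≤⟨ spread ⟩
    x                       ≤⟨ x≤r ⟩
    + r                     ∎)

leftRest≅ : ∀ r → VecIso (Restrict (Left (suc r)) head (_≢ + suc r)) (Left r)
leftRest≅ r = record
  { to         = init
  ; from       = _∷ʳ + 0
  ; to-in      = to-in
  ; from-in    = from-in
  ; from-to    = λ {v} rest →
      trans (cong (init v ∷ʳ_) (sym (leftRest-last≡0 rest))) (init-∷ʳ-last v)
  ; to-from    = init-∷ʳ (+ 0)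
  ; to-zipWith = init-zipWith
  }
  where
  to-in : ∀ {v} → Restrict (Left (suc r)) head (_≢ + suc r) v → Left r (init v)
  to-in {x ∷ _} ((bnds , ch) , x≢) =
    all-init (All.map below (All.zip (bnds , chain⇒head-maximal ch))) , chain-init ch
    where
    x≤r : x ℤ.≤ + r
    x≤r = ℤP.i<j⇒i≤pred[j] (ℤP.≤∧≢⇒< (proj₂ (All.head bnds)) x≢)
    below : Within (+ 0) (+ suc r) y × y ℤ.≤ x → Within (+ 0) (+ r) y
    below ((0≤y , _) , y≤x) = 0≤y , ℤP.≤-trans y≤x x≤r
  from-in : ∀ {w} → Left r w → Restrict (Left (suc r)) head (_≢ + suc r) (w ∷ʳ + 0)
  from-in {w} (bnds , ch) =
    (All.map within-weakenʳ bnds′ , ∷ʳ-chain (All.map (≻₀-zero ∘ proj₁) bnds) ch) ,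
    ℤP.<⇒≢ (ℤP.i≤pred[j]⇒i<j (proj₂ (all-head bnds′)))
    where
    bnds′ : All (Within (+ 0) (+ r)) (w ∷ʳ + 0)
    bnds′ = all-∷ʳ bnds (ℤP.≤-refl , +≤+ z≤n)

rightBottom≅ : ∀ m → VecIso (Restrict (Right (suc m)) last (_≡ -[1+ m ])) (Right m)
rightBottom≅ m = record
  { to         = init
  ; from       = _∷ʳ -[1+ m ]
  ; to-in      = to-in
  ; from-in    = from-in
  ; from-to    = λ {v} (_ , last≡) → trans (cong (init v ∷ʳ_) (sym last≡)) (init-∷ʳ-last v)
  ; to-from    = init-∷ʳ -[1+ m ]
  ; to-zipWith = init-zipWith
  }
  where
  above : Within -[1+ m ] (+ 0) y × y ≻₀ -[1+ m ] → Within (- (+ m)) (+ 0) y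
  above ((_ , y≤0) , d) = -[1+m]<⇒-m≤ m (≻₀⇒<ʳ d (λ ())) , y≤0
  to-in : ∀ {v} → Restrict (Right (suc m)) last (_≡ -[1+ m ]) v → Right m (init v)
  to-in {v} ((bnds , ch) , last≡) =
    All.map above (All.zip (all-init bnds ,
      subst (λ b → All (_≻₀ b) (init v)) last≡ (chain⇒last-dominated ch))) ,
    chain-init ch
  from-in : ∀ {w} → Right m w → Restrict (Right (suc m)) last (_≡ -[1+ m ]) (w ∷ʳ -[1+ m ])
  from-in {w} (bnds , ch) =
    (all-∷ʳ (All.map within-weakenˡ bnds) (ℤP.≤-refl , -≤+) ,
     ∷ʳ-chain (All.map (inj₁ ∘ -m≤⇒-[1+m]< m ∘ proj₁) bnds) ch) ,
    last-∷ʳ -[1+ m ] w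

rightRest-head≡0 : ∀ {m} {v} → Restrict (Right (suc m)) last (_≢ -[1+ m ]) v → head v ≡ + 0
rightRest-head≡0 {m} {x ∷ xs} ((bnds , ch) , last≢) =
  ℤP.≤-antisym (proj₂ (All.head bnds)) (ℤP.≮⇒≥ x≮0)
  where
  open ℤP.≤-Reasoning
  m≤last : - (+ m) ℤ.≤ last (x ∷ xs)
  m≤last = -[1+m]<⇒-m≤ m (ℤP.≤∧≢⇒< (proj₁ (all-last bnds)) (≢-sym last≢))
  x≮0 : ¬ (x ℤ.< + 0)
  x≮0 x<0 with chain-spread ch
  ... | inj₂ (_ , 0≤x) = ℤP.<⇒≱ x<0 0≤x
  ... | inj₁ spread = ℤP.<-irrefl refl (begin-strict
    + 0                     ≡⟨ sym (ℤP.+-inverseʳ (+ m)) ⟩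
    + m ℤ.+ - (+ m)         ≤⟨ ℤP.+-monoʳ-≤ (+ m) m≤last ⟩
    + m ℤ.+ last (x ∷ xs)   ≤⟨ spread ⟩
    x                       <⟨ x<0 ⟩
    + 0                     ∎)

rightRest≅ : ∀ m → VecIso (Restrict (Right (suc m)) last (_≢ -[1+ m ])) (Right m)
rightRest≅ m = record
  { to         = tail
  ; from       = + 0 ∷_
  ; to-in      = to-in
  ; from-in    = from-in
  ; from-to    = λ { {_ ∷ xs} rest → cong (_∷ xs) (sym (rightRest-head≡0 rest)) }
  ; to-from    = λ _ → refl
  ; to-zipWith = λ { _ (_ ∷ _) (_ ∷ _) → refl }
  }
  where
  to-in : ∀ {v} → Restrict (Right (suc m)) last (_≢ -[1+ m ]) v → Right m (tail v)
  to-in {v@(_ ∷ _)} ((bnds , ch) , last≢) =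
    All.map above (All.zip (All.tail bnds , All.tail (chain⇒last-minimal ch))) , Linked.tail ch
    where
    lo<last : -[1+ m ] ℤ.< last v
    lo<last = ℤP.≤∧≢⇒< (proj₁ (all-last bnds)) (≢-sym last≢)
    above : Within -[1+ m ] (+ 0) y × last v ℤ.≤ y → Within (- (+ m)) (+ 0) y
    above ((_ , y≤0) , last≤y) = -[1+m]<⇒-m≤ m (ℤP.<-≤-trans lo<last last≤y) , y≤0
  from-in : ∀ {w} → Right m w → Restrict (Right (suc m)) last (_≢ -[1+ m ]) (+ 0 ∷ w)
  from-in {w} (bnds , ch) =
    (All.map within-weakenˡ bnds′ , ∷-chain (All.map (zero-≻₀ ∘ proj₂) bnds) ch) ,
    ≢-sym (ℤP.<⇒≢ (-m≤⇒-[1+m]< m (proj₁ (all-last bnds′))))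
    where
    bnds′ : All (Within (- (+ m)) (+ 0)) (+ 0 ∷ w)
    bnds′ = (ℤP.neg-≤-pos , ℤP.≤-refl) ∷ bnds

record Bisection (OK : Vec ℤ k → Set) (OK' : Vec ℤ l → Set) : Set where
  field
    coord         : Vec ℤ k → ℤ
    coord-zipWith : ∀ _∙_ v v' → coord (zipWith _∙_ v v') ≡ coord v ∙ coord v'
    value         : ℤ
    fibre≅        : VecIso (Restrict OK coord (_≡ value)) OK'
    cofibre≅      : VecIso (Restrict OK coord (_≢ value)) OK'

leftBisection : ∀ r → Bisection (Left (suc r)) (Left r)
leftBisection r = record
  { coord         = head
  ; coord-zipWith = λ { _ (_ ∷ _) (_ ∷ _) → refl }
  ; value         = + suc r
  ; fibre≅        = leftTop≅ r
  ; cofibre≅      = leftRest≅ r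
  }

rightBisection : ∀ m → Bisection (Right (suc m)) (Right m)
rightBisection m = record
  { coord         = last
  ; coord-zipWith = last-zipWith
  ; value         = -[1+ m ]
  ; fibre≅        = rightBottom≅ m
  ; cofibre≅      = rightRest≅ m
  }
  where
  last-zipWith : ∀ {k} _∙_ (v v' : Vec ℤ (suc k)) → last (zipWith _∙_ v v') ≡ last v ∙ last v'
  last-zipWith _∙_ (_ ∷ [])        (_ ∷ [])        = refl
  last-zipWith _∙_ (_ ∷ v@(_ ∷ _)) (_ ∷ v'@(_ ∷ _)) = last-zipWith _∙_ v v'

restrict-closed : ∀ {OK : Vec ℤ k → Set} {f} (C : ℤ → Set) → Closed OK →
  (∀ _∙_ v v' → f (zipWith _∙_ v v') ≡ f v ∙ f v') → Closed (Restrict OK f C)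
restrict-closed C closed f-zipWith {v} {w} (ok , c) (ok' , c') =
  (proj₁ (closed ok ok') ,
   subst C (sym (f-zipWith _⊓_ v w)) (selective-preserves C ℤP.⊓-sel c c')) ,
  (proj₂ (closed ok ok') ,
   subst C (sym (f-zipWith _⊔_ v w)) (selective-preserves C ℤP.⊔-sel c c'))

restrict-cover : ∀ {OK : Vec ℤ k → Set} {f v} c → OK v →
  Restrict OK f (_≡ c) v ⊎ Restrict OK f (_≢ c) v
restrict-cover {f = f} {v} c ok with f v ℤ.≟ c
... | yes fv≡c = inj₁ (ok , fv≡c)
... | no fv≢c  = inj₂ (ok , fv≢c)

idIso : {P : Vec ℤ k → Set} → VecIso P P
idIso = record
  { to = id ; from = id ; to-in = id ; from-in = id
  ; from-to = λ _ → refl ; to-from = λ _ → refl ; to-zipWith = λ _ _ _ → refl }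

module _ {n r : ℕ} where

  _⊗_ : (Vec ℤ r → Set) → (Vec ℤ (n ∸ r) → Set) → Str n r → Set
  (P ⊗ Q) (i , j) = P i × Q j

  ⊗-isSublattice : ∀ {P Q} → (∀ {i} → P i → Left r i) → (∀ {j} → Q j → Right (n ∸ r) j) →
    Closed P → Closed Q → IsSublattice n r (P ⊗ Q)
  ⊗-isSublattice P⊆ Q⊆ closedP closedQ = record
    { sub     = λ _ (p , q) → Left⇒leftOK (P⊆ p) , Right⇒rightOK (Q⊆ q)
    ; closed∧ = λ _ _ (p , q) (p' , q') → proj₁ (closedP p p') , proj₁ (closedQ q q')
    ; closed∨ = λ _ _ (p , q) (p' , q') → proj₂ (closedP p p') , proj₂ (closedQ q q')
    }

  ⊗-latIso : ∀ {P Q n' r'} → VecIso P (Left r') → VecIso Q (Right (n' ∸ r')) →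
    LatIso n r (P ⊗ Q) n' r'
  ⊗-latIso I J = record
    { to      = λ (i , j) → I.to i , J.to j
    ; from    = λ (i , j) → I.from i , J.from j
    ; to-in   = λ _ (p , q) → Left⇒leftOK (I.to-in p) , Right⇒rightOK (J.to-in q)
    ; from-in = λ _ (ok , ok') → I.from-in (leftOK⇒Left ok) , J.from-in (rightOK⇒Right ok')
    ; from-to = λ _ (p , q) → cong₂ _,_ (I.from-to p) (J.from-to q)
    ; to-from = λ (i , j) _ → cong₂ _,_ (I.to-from i) (J.to-from j)
    ; to-∧    = λ (i , j) (i' , j') _ _ → cong₂ _,_ (I.to-zipWith _⊓_ i i') (J.to-zipWith _⊓_ j j')
    ; to-∨    = λ (i , j) (i' , j') _ _ → cong₂ _,_ (I.to-zipWith _⊔_ i i') (J.to-zipWith _⊔_ j j')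
    }
    where
    module I = VecIso I
    module J = VecIso J

  SplitsInto : ℕ → ℕ → Set₁
  SplitsInto n' r' = Σ (Str n r → Set) λ S₁ → Σ (Str n r → Set) λ S₂ →
    IsSublattice n r S₁ × IsSublattice n r S₂
    × (∀ w → S₁ w → S₂ w → ⊥)
    × (∀ w → InS n r w → S₁ w ⊎ S₂ w)
    × LatIso n r S₁ n' r' × LatIso n r S₂ n' r'

  splitLeftHalf : ∀ {n' r'} → Bisection (Left r) (Left r') →
    VecIso (Right (n ∸ r)) (Right (n' ∸ r')) → SplitsInto n' r'
  splitLeftHalf B J =
    Restrict (Left r) coord (_≡ value) ⊗ Right (n ∸ r) ,
    Restrict (Left r) coord (_≢ value) ⊗ Right (n ∸ r) ,
    ⊗-isSublattice proj₁ id (restrict-closed′ (_≡ value)) chainIn-closed ,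
    ⊗-isSublattice proj₁ id (restrict-closed′ (_≢ value)) chainIn-closed ,
    (λ _ ((_ , fv≡c) , _) ((_ , fv≢c) , _) → fv≢c fv≡c) ,
    (λ _ (ok , ok') → Sum.map (_, rightOK⇒Right ok') (_, rightOK⇒Right ok')
                     (restrict-cover {OK = Left r} {coord} value (leftOK⇒Left ok))) ,
    ⊗-latIso fibre≅ J , ⊗-latIso cofibre≅ J
    where
    open Bisection B
    restrict-closed′ : ∀ C → Closed (Restrict (Left r) coord C)
    restrict-closed′ C = restrict-closed C chainIn-closed coord-zipWith

  splitRightHalf : ∀ {n'} → Bisection (Right (n ∸ r)) (Right (n' ∸ r)) → SplitsInto n' r
  splitRightHalf B =
    Left r ⊗ Restrict (Right (n ∸ r)) coord (_≡ value) ,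
    Left r ⊗ Restrict (Right (n ∸ r)) coord (_≢ value) ,
    ⊗-isSublattice id proj₁ chainIn-closed (restrict-closed′ (_≡ value)) ,
    ⊗-isSublattice id proj₁ chainIn-closed (restrict-closed′ (_≢ value)) ,
    (λ _ (_ , (_ , fv≡c)) (_ , (_ , fv≢c)) → fv≢c fv≡c) ,
    (λ _ (ok , ok') → Sum.map (leftOK⇒Left ok ,_) (leftOK⇒Left ok ,_)
                     (restrict-cover {OK = Right (n ∸ r)} {coord} value (rightOK⇒Right ok'))) ,
    ⊗-latIso idIso fibre≅ , ⊗-latIso idIso cofibre≅
    where
    open Bisection B
    restrict-closed′ : ∀ C → Closed (Restrict (Right (n ∸ r)) coord C)
    restrict-closed′ C = restrict-closed C chainIn-closed coord-zipWith

mainTheorem11 : (n r : ℕ) → 1 ≤ n → r ≤ n →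
    Σ (Str n r → Set) λ S₁ → Σ (Str n r → Set) λ S₂ →
      IsSublattice n r S₁ × IsSublattice n r S₂
      × (∀ w → S₁ w → S₂ w → ⊥)
      × (∀ w → InS n r w → S₁ w ⊎ S₂ w)
      × (r < n → LatIso n r S₁ (n ∸ 1) r × LatIso n r S₂ (n ∸ 1) r)
      × (r ≡ n → LatIso n r S₁ (n ∸ 1) (n ∸ 1) × LatIso n r S₂ (n ∸ 1) (n ∸ 1))
mainTheorem11 (suc n') r _ r≤n with r ℕP.≤? n'
... | yes r≤n' =
  let S₁ , S₂ , sub₁ , sub₂ , disjoint , cover , iso₁ , iso₂ = splitRightHalf right-half-bisection
  in  S₁ , S₂ , sub₁ , sub₂ , disjoint , cover ,
      (λ _ → iso₁ , iso₂) , (λ r≡n → ⊥-elim (ℕP.<⇒≢ (s≤s r≤n') r≡n))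
  where
  right-half-bisection : Bisection (Right (suc n' ∸ r)) (Right (n' ∸ r))
  right-half-bisection = subst (λ a → Bisection (Right a) (Right (n' ∸ r)))
    (sym (ℕP.+-∸-assoc 1 r≤n')) (rightBisection (n' ∸ r))
... | no r≰n' with ℕP.≤-antisym r≤n (ℕP.≰⇒> r≰n')
...   | refl =
  let S₁ , S₂ , sub₁ , sub₂ , disjoint , cover , iso₁ , iso₂ = splitLeftHalf (leftBisection n') idIso
  in  S₁ , S₂ , sub₁ , sub₂ , disjoint , cover ,
      (λ n<n → ⊥-elim (ℕP.<-irrefl refl n<n)) , (λ _ → iso₁ , iso₂)
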